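{- Consider the variation of the temporal graph discovery game with temporal multigraphs. For every temporal multigraph $\mathcal{G}$ with lifetime $T_{\max}$ and every $\delta,k\in\mathbb{N}^+$, the algorithm $\mathtt{DiscoveryFollow}$ wins the game on $\mathcal{G}$ in at most $6|E(\mathcal{G})|+c_\delta(\mathcal{G})\lceil T_{\max}/\delta\rceil$ rounds, where $|E(\mathcal{G})|$ counts every multiedge individually and $c_\delta(\mathcal{G})$ is the number of $\delta$-edge connected components of $\mathcal{G}$.
   Context: A temporal multigraph with lifetime $T_{\max}$ consists of a finite node set $V$, a finite multiset of undirected edges $E$ (several distinct edges may join the same two nodes), and a labeling $\lambda:E\to\{1,\dots,T_{\max}\}$ such that no two parallel edges have the same label. $\delta$-edge connected components: relate two edges if they share an endpoint and their labels differ by at most $\delta$; the equivalence classes of the reflexive-transitive closure are the $\delta$-edge connected components. Infection model with parameter $\delta$: all nodes start susceptible; a seed infection $(v,t)$ makes $v$ infected at time $t$; otherwise a susceptible node $u$ becomes infected at time $t$ iff some node $w$ infectious at time $t$ has an edge $uw$ with label $t$ (if several, exactly one infects $u$); a node infected at time $t$ is infectious at times $t+1,\dots,t+\delta$ and resistant afterwards. An infection log is the set of triples $(u,w,s)$ ($u$ infected $w$ at time $s$, hence via the unique edge $uw$ with label $s$; seeds as $(u,u,s)$), consistent with a seed set if some chain with these seeds produces it. TGD game, multigraph variation: the Discoverer learns $V$ and the static multigraph (including multiplicities); each round it submits at most $k$ seed infections and the Adversary answers with a consistent infection log; to end, the Discoverer submits a temporal multigraph and the Adversary responds with one (same static multigraph)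 consistent with all logs; the Adversary wins if they differ, otherwise the Discoverer wins. Subroutine $\mathtt{Explore}(u,t)$: (1) for each $t'\in\{t-\delta-1,t-1,t\}$, if no round with seed infection $(u,t')$ has been performed, perform a round with the single seed $(u,t')$ and record it; (2) for each edge $uw$ along which $u$ newly infected $w$ in these rounds, at time $s$, call $\mathtt{Explore}(w,s)$. Algorithm $\mathtt{DiscoveryFollow}$: while there is a node $v_0$ with an adjacent edge whose label is still unknown: perform rounds seed-infecting $v_0$ (alone) at times $0,\delta,2\delta,\dots$ up to $T_{\max}$; for each edge $e=v_0u$ along which $v_0$ successfully infected $u$, call $\mathtt{Explore}(u,\lambda(e))$. At the end it submits the graph with all learned labels. -}

module Defs where

open import Data.Nat as ℕ using (ℕ; zero; suc; _*_; _∸_; NonZero)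
open import Data.Nat.DivMod using (_/_)
open import Data.Integer as ℤ using (ℤ; +_)
open import Data.Fin as Fin using (Fin)
open import Data.Fin.Properties using () renaming (_≟_ to _≟F_)
open import Data.Product using (Σ; ∃; _×_; _,_; proj₁; proj₂; swap)
open import Data.Product.Properties using (≡-dec)
open import Data.Sum using (_⊎_)
open import Data.Maybe using (Maybe; just; nothing)
open import Data.Bool using (Bool; true; false; if_then_else_; _∧_; not)
open import Data.List using (List; []; _∷_; _++_; [_]; length; map; filter; upTo; concatMap; mapMaybe; deduplicate; allFin)
open import Data.List.Relation.Unary.Any using (Any)
open import Data.List.Relation.Unary.All using (All)
open import Relation.Binary.PropositionalEquality using (_≡_; _≢_)
open import Relation.Nullary using (¬_; does)
open import Relation.Binary.Construct.Closure.ReflexiveTransitive using (Star)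
open import Function.Bundles using (_⇔_)

ceilDiv : (a b : ℕ) → .{{_ : NonZero b}} → ℕ
ceilDiv a b = (a ℕ.+ (b ∸ 1)) / b

-- Everything below is relative to a fixed static multigraph:
-- nodes Fin n, edges Fin m (a multiset of edges), endpoints ends e,
-- together with the parameters δ and the lifetime Tmax.

module Game (n m : ℕ) (ends : Fin m → Fin n × Fin n) (δ Tmax : ℕ) where

  SameEnds : Fin m → Fin m → Set
  SameEnds e e' = (ends e ≡ ends e') ⊎ (ends e ≡ swap (ends e'))

  ValidLab : (Fin m → ℕ) → Set
  ValidLab lab =
    (∀ e → 1 ℕ.≤ lab e × lab e ℕ.≤ Tmax) ×
    (∀ e e' → e ≢ e' → SameEnds e e' → lab e ≢ lab e')

  EdgeAt : (Fin m → ℕ) → Fin n → Fin n → ℤ → Set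
  EdgeAt lab u w s =
    Σ (Fin m) λ e → ((ends e ≡ (u , w)) ⊎ (ends e ≡ (w , u))) × (+ lab e ≡ s)

  ShareEnd : Fin m → Fin m → Set
  ShareEnd e e' =
    (proj₁ (ends e) ≡ proj₁ (ends e')) ⊎ (proj₁ (ends e) ≡ proj₂ (ends e')) ⊎
    (proj₂ (ends e) ≡ proj₁ (ends e')) ⊎ (proj₂ (ends e) ≡ proj₂ (ends e'))

  DeltaRel : (Fin m → ℕ) → Fin m → Fin m → Set
  DeltaRel lab e e' =
    ShareEnd e e' × (lab e ℕ.≤ lab e' ℕ.+ δ) × (lab e' ℕ.≤ lab e ℕ.+ δ)

  -- c is the number of δ-edge connected components of lab:
  -- there is a surjective class map whose fibres are exactly the
  -- classes of the reflexive-transitive closure of DeltaRel.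
  NumComponents : (Fin m → ℕ) → ℕ → Set
  NumComponents lab c =
    Σ (Fin m → Fin c) λ cls →
      (∀ i → ∃ λ e → cls e ≡ i) ×
      (∀ e e' → (cls e ≡ cls e') ⇔ Star (DeltaRel lab) e e')

  -- An infection log is encoded as a map  w ↦ just (u , s)  meaning the
  -- triple (u , w , s) is in the log (u infected w at time s; for the
  -- seed, u = w), and  w ↦ nothing  meaning w is never infected.

  Log : Set
  Log = Fin n → Maybe (Fin n × ℤ)

  Seed : Set
  Seed = Fin n × ℤ

  Infected : Log → Fin n → ℤ → Set
  Infected L u s = ∃ λ x → L u ≡ just (x , s)

  Infectious : Log → Fin n → ℤ → Set
  Infectious L u t = ∃ λ s → Infected L u s × (s ℤ.< t) × (t ℤ.≤ s ℤ.+ + δ)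

  CanInfect : (Fin m → ℕ) → Log → Fin n → ℤ → Set
  CanInfect lab L w t = ∃ λ u → Infectious L u t × EdgeAt lab u w t

  Consistent : (Fin m → ℕ) → Seed → Log → Set
  Consistent lab (v0 , t0) L =
    (L v0 ≡ just (v0 , t0)) ×
    (∀ w → w ≢ v0 →
      ((L w ≡ nothing → ∀ t → ¬ CanInfect lab L w t) ×
       (∀ u t → L w ≡ just (u , t) →
          Infectious L u t × EdgeAt lab u w t ×
          (∀ t' → t' ℤ.< t → ¬ CanInfect lab L w t'))))

  Round : Set
  Round = Seed × Log

  Hist : Set
  Hist = List Round

  Learned : Hist → Fin n → Fin n → ℤ → Set
  Learned H a b s =
    Any (λ r → (a ≢ b) × ((proj₂ r b ≡ just (a , s)) ⊎ (proj₂ r a ≡ just (b , s)))) H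

  Known : (Fin m → ℕ) → Hist → Fin m → Set
  Known lab H e = Learned H (proj₁ (ends e)) (proj₂ (ends e)) (+ lab e)

  Performed : Hist → Seed → Set
  Performed H σ = Any (λ r → proj₁ r ≡ σ) H

  -- The Discoverer wins with submission "all learned labels":
  -- every temporal multigraph on the same static multigraph that is
  -- consistent with all logs coincides with the submitted one.
  Wins : Hist → Set
  Wins H =
    ∀ lab' → ValidLab lab' → All (λ r → Consistent lab' (proj₁ r) (proj₂ r)) H →
    ∀ a b s → EdgeAt lab' a b s ⇔ Learned H a b s

  -- The algorithm DiscoveryFollow as a nondeterministic transition system.

  mainTimes : List ℤ
  mainTimes = map +_ (filter (λ t → t ℕ.<? Tmax) (map (λ j → j * δ) (upTo (suc Tmax))))

  exploreTimes : ℤ → List ℤ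
  exploreTimes t = (t ℤ.- + suc δ) ∷ (t ℤ.- + 1) ∷ t ∷ []

  newInf : Fin n → List Log → List (Fin n × ℤ)
  newInf u ls = deduplicate (≡-dec _≟F_ ℤ._≟_) (concatMap pick ls)
    where
    pickOne : Log → Fin n → Maybe (Fin n × ℤ)
    pickOne L w with L w
    ... | nothing = nothing
    ... | just (x , s) =
      if does (x ≟F u) ∧ not (does (w ≟F u)) then just (w , s) else nothing
    pick : Log → List (Fin n × ℤ)
    pick L = mapMaybe (pickOne L) (allFin n)

  -- stack frames
  --  seeding u skip ts ls : performing the seed rounds of u at the times ts;
  --     skip = true : rounds already performed are skipped (Explore step 1)
  --     skip = false: rounds are always performed (main loop)
  --     ls : logs of the rounds performed so far by this frame
  --  calls ps : the pending Explore calls (in any order)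
  data Frame : Set where
    seeding : Fin n → Bool → List ℤ → List Log → Frame
    calls   : List (Fin n × ℤ) → Frame

  record State : Set where
    constructor ⟨_,_⟩
    field
      hist  : Hist
      stack : List Frame
  open State public

  init : State
  init = ⟨ [] , [] ⟩

  rounds : State → ℕ
  rounds s = length (hist s)

  history : State → Hist
  history s = hist s

  explore : Fin n → ℤ → Frame
  explore u t = seeding u true (exploreTimes t) []

  -- one step of the algorithm; lab is the hidden temporal multigraph,
  -- each round is answered by an arbitrary log consistent with it
  data Step (lab : Fin m → ℕ) : State → State → Set where
    round : ∀ {H u b t ts ls st} L →
      (b ≡ false ⊎ ¬ Performed H (u , t)) →
      Consistent lab (u , t) L →
      Step lab ⟨ H , seeding u b (t ∷ ts) ls ∷ st ⟩
               ⟨ H ++ [ ((u , t) , L) ] , seeding u b ts (L ∷ ls) ∷ st ⟩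
    skip : ∀ {H u t ts ls st} →
      Performed H (u , t) →
      Step lab ⟨ H , seeding u true (t ∷ ts) ls ∷ st ⟩
               ⟨ H , seeding u true ts ls ∷ st ⟩
    seeded : ∀ {H u b ls st} →
      Step lab ⟨ H , seeding u b [] ls ∷ st ⟩
               ⟨ H , calls (newInf u ls) ∷ st ⟩
    call : ∀ {H xs w s ys st} →
      Step lab ⟨ H , calls (xs ++ (w , s) ∷ ys) ∷ st ⟩
               ⟨ H , explore w s ∷ calls (xs ++ ys) ∷ st ⟩
    return : ∀ {H st} →
      Step lab ⟨ H , calls [] ∷ st ⟩ ⟨ H , st ⟩
    iterate : ∀ {H} v0 e →
      (proj₁ (ends e) ≡ v0 ⊎ proj₂ (ends e) ≡ v0) →
      ¬ Known lab H e →
      Step lab ⟨ H , [] ⟩ ⟨ H , seeding v0 false mainTimes [] ∷ [] ⟩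

  Final : (Fin m → ℕ) → State → Set
  Final lab s = (stack s ≡ []) × (∀ e → Known lab (hist s) e)

-- Explore(u, t) seeds u at t − δ − 1, t − 1 and t, and every infection logged by a round is followed by such
-- an exploration; the round seeding u at t − 1 reveals every edge at u labelled t. The key lemma: if u is seeded
-- at t₀ and an edge ux is labelled N with t₀ < N ≤ t₀ + δ, then x gets explored at N. In the round seeded at t₀,
-- x is infected at some N₁ ≤ N, either by u or by an earlier infected node; exploring that node (or x at N₁ < N)
-- uses a seed time closer to N, so the lemma follows by induction on N and on the distance from t₀ to N. As the
-- three seeds of Explore(u, T) cover every label within δ of T, exploration spreads along δ-edge connectivity,
-- and a main loop at v₀, whose seeds 0, δ, 2δ, … cover every label, reveals the whole δ-edge component of an
-- unknown edge at v₀. So at most c main loops run, each of at most ⌈Tmax/δ⌉ rounds, while the other rounds seed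
-- distinct pairs (w, t), w an endpoint of an edge e and t an explore time of λ(e): at most 6|E| of them. When
-- every label is known, a competing labelling consistent with the logs contains every revealed edge, and since
-- no two parallel edges share a label it has no other edges.

module Submission where

open import Algebra.Properties.AbelianGroup using (//-rightDividesˡ; //-rightDividesʳ)
open import Data.Bool using (Bool; true; false)
open import Data.Fin using (Fin; punchOut)
open import Data.Fin.Properties
  using (any?; all?; ¬∀⟶∃¬; injective⇒≤; punchOut-injective) renaming (_≟_ to _≟ᶠ_)
open import Data.Integer as ℤ using (ℤ; +_; +≤+; +<+; ∣_∣)
import Data.Integer.Properties as ℤP
open import Data.List using (List; []; _∷_; [_]; _++_; length; map; filter; upTo; allFin; mapMaybe; concatMap)
open import Data.List.Membership.Propositional using (_∈_; _∉_; find; lose)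
open import Data.List.Membership.Propositional.Properties
  using ( ∈-map⁺; ∈-map⁻; ∈-++⁺ˡ; ∈-++⁺ʳ; ∈-++⁻; ∈-filter⁺; ∈-filter⁻; ∈-upTo⁺
        ; ∈-allFin; ∈-concatMap⁺; ∈-concatMap⁻; ∈-deduplicate⁺; ∈-deduplicate⁻)
open import Data.List.Properties
  using (length-removeAt′; length-map; length-upTo; length-++; length-++-sucʳ; length-tabulate)
open import Data.List.Relation.Binary.Subset.Propositional using (_⊆_)
open import Data.List.Relation.Unary.All as All using (All; []; _∷_)
import Data.List.Relation.Unary.All.Properties as AllP
open import Data.List.Relation.Unary.Any as Any using (Any; here; there)
import Data.List.Relation.Unary.Any.Properties as AnyP
open import Data.List.Relation.Unary.Unique.Propositional using (Unique; []; _∷_)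
import Data.List.Relation.Unary.Unique.Propositional.Properties as Unique
open import Data.Maybe using (Maybe; just; nothing)
open import Data.Maybe.Properties using (just-injective) renaming (≡-dec to ≡-decₘ)
import Data.Maybe.Relation.Unary.Any as Maybe
open import Data.Nat as ℕ using (ℕ; zero; suc; z≤n; s≤s; _≤_; _<_; _+_; _*_; _∸_; NonZero)
open import Data.Nat.DivMod using (_/_; _%_; m≡m%n+[m/n]*n; m%n<n; m/n*n≤m; m*n/n≡m; /-monoˡ-≤)
open import Data.Nat.Induction using (<-rec; <-wellFounded)
import Data.Nat.Properties as ℕP
open import Data.Product using (∃; ∃₂; _×_; _,_; proj₁; proj₂; map₁; map₂; swap)
open import Data.Product.Properties using (≡-dec)
open import Data.Product.Relation.Binary.Lex.Strict using (×-Lex; ×-wellFounded)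
open import Data.Sum as Sum using (_⊎_; inj₁; inj₂)
open import Function.Base using (_∘_; id)
open import Function.Bundles using (mk⇔; Equivalence)
open import Function.Definitions using (Injective)
open import Induction.WellFounded using (Acc; acc; WellFounded)
open import Relation.Binary.Construct.Closure.ReflexiveTransitive using (Star; ε; _◅_)
open import Relation.Binary.PropositionalEquality hiding ([_])
open import Relation.Nullary using (¬_; Dec; yes; no; contradiction; ¬?)
open import Relation.Nullary.Decidable using (_×-dec_; _⊎-dec_)

open import Defs

∈-─⁺ : ∀ {A : Set} {x y : A} {ys} (x∈ys : x ∈ ys) → y ∈ ys → y ≢ x → y ∈ (ys Any.─ x∈ys)
∈-─⁺ (here refl)  (here refl)  y≢x = contradiction refl y≢x
∈-─⁺ (here refl)  (there y∈ys) _   = y∈ys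
∈-─⁺ (there _)    (here refl)  _   = here refl
∈-─⁺ (there x∈ys) (there y∈ys) y≢x = there (∈-─⁺ x∈ys y∈ys y≢x)

unique-⊆⇒length≤ : ∀ {A : Set} {xs ys : List A} → Unique xs → xs ⊆ ys → length xs ≤ length ys
unique-⊆⇒length≤ {xs = []}     _             _     = z≤n
unique-⊆⇒length≤ {xs = x ∷ xs} {ys} (x∉xs ∷ xs!) xs⊆ys = begin
  suc (length xs)              ≤⟨ s≤s (unique-⊆⇒length≤ xs! xs⊆ys─x) ⟩
  suc (length (ys Any.─ x∈ys)) ≡⟨ length-removeAt′ ys (Any.index x∈ys) ⟨
  length ys                    ∎
  where
  open ℕP.≤-Reasoning
  x∈ys : x ∈ ys
  x∈ys = xs⊆ys (here refl)
  xs⊆ys─x : xs ⊆ (ys Any.─ x∈ys)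
  xs⊆ys─x y∈xs = ∈-─⁺ x∈ys (xs⊆ys (there y∈xs)) (λ y≡x → All.lookup x∉xs y∈xs (sym y≡x))

injective⇒surjective : ∀ {k} {f : Fin k → Fin k} → Injective _≡_ _≡_ f → ∀ y → ∃ λ x → f x ≡ y
injective⇒surjective {suc k} {f} f-injective y with any? (λ x → f x ≟ᶠ y)
... | yes hit = hit
... | no miss = contradiction (injective⇒≤ punched-injective) ℕP.1+n≰n
  where
  y≢f : ∀ x → y ≢ f x
  y≢f x y≡fx = miss (x , sym y≡fx)
  punched-injective : Injective _≡_ _≡_ (λ x → punchOut (y≢f x))
  punched-injective eq = f-injective (punchOut-injective (y≢f _) (y≢f _) eq)

∈-mapMaybe⁺ : ∀ {A B : Set} (f : A → Maybe B) {xs x y} → x ∈ xs → f x ≡ just y → y ∈ mapMaybe f xs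
∈-mapMaybe⁺ f x∈xs fx≡y =
  AnyP.mapMaybe⁺ f _ (AnyP.map⁺ (Any.map (λ { refl → subst (Maybe.Any _) (sym fx≡y) (Maybe.just refl) }) x∈xs))

∈-mapMaybe⁻ : ∀ {A B : Set} (f : A → Maybe B) xs {y} → y ∈ mapMaybe f xs →
              ∃ λ x → x ∈ xs × f x ≡ just y
∈-mapMaybe⁻ f (x ∷ xs) y∈ with f x in fx≡
... | nothing = map₂ (map₁ there) (∈-mapMaybe⁻ f xs y∈)
... | just _ with y∈
...   | here refl = x , here refl , fx≡
...   | there y∈′ = map₂ (map₁ there) (∈-mapMaybe⁻ f xs y∈′)

∉-mapMaybe : ∀ {A B : Set} (f : A → Maybe B) {xs x y} → x ∈ xs → y ∉ mapMaybe f xs → f x ≢ just y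
∉-mapMaybe f x∈xs y∉ fx≡y = y∉ (∈-mapMaybe⁺ f x∈xs fx≡y)

i<i+1 : ∀ i → i ℤ.< i ℤ.+ + 1
i<i+1 i = ℤP.suc[i]≤j⇒i<j (ℤP.≤-reflexive (ℤP.+-comm (+ 1) i))

i<j⇒i+1≤j : ∀ {i j} → i ℤ.< j → i ℤ.+ + 1 ℤ.≤ j
i<j⇒i+1≤j {i} i<j = subst (ℤ._≤ _) (ℤP.+-comm (+ 1) i) (ℤP.i<j⇒suc[i]≤j i<j)

i-1+1≡i : ∀ i → i ℤ.- + 1 ℤ.+ + 1 ≡ i
i-1+1≡i i = //-rightDividesˡ ℤP.+-0-abelianGroup (+ 1) i

i<j+k⇒i-k<j : ∀ {i j k} → i ℤ.< j ℤ.+ k → i ℤ.- k ℤ.< j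
i<j+k⇒i-k<j {i} {j} {k} i<j+k =
  subst (i ℤ.- k ℤ.<_) (//-rightDividesʳ ℤP.+-0-abelianGroup k j) (ℤP.+-monoˡ-< (ℤ.- k) i<j+k)

j+k≤i+l⇒j≤i-k+l : ∀ {i j k l} → j ℤ.+ k ℤ.≤ i ℤ.+ l → j ℤ.≤ i ℤ.- k ℤ.+ l
j+k≤i+l⇒j≤i-k+l {i} {j} {k} {l} j+k≤i+l =
  subst₂ ℤ._≤_ (//-rightDividesʳ ℤP.+-0-abelianGroup k j) i+l-k≡i-k+l (ℤP.+-monoˡ-≤ (ℤ.- k) j+k≤i+l)
  where
  open ≡-Reasoning
  i+l-k≡i-k+l : i ℤ.+ l ℤ.- k ≡ i ℤ.- k ℤ.+ l
  i+l-k≡i-k+l = begin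
    i ℤ.+ l ℤ.- k       ≡⟨ ℤP.+-assoc i l (ℤ.- k) ⟩
    i ℤ.+ (l ℤ.- k)     ≡⟨ cong (λ z → i ℤ.+ z) (ℤP.+-comm l (ℤ.- k)) ⟩
    i ℤ.+ (ℤ.- k ℤ.+ l) ≡⟨ ℤP.+-assoc i (ℤ.- k) l ⟨
    i ℤ.- k ℤ.+ l       ∎

∣j-k∣<∣i-k∣ : ∀ {i j k} → i ℤ.< j → j ℤ.≤ k → ∣ j ℤ.- k ∣ < ∣ i ℤ.- k ∣
∣j-k∣<∣i-k∣ {i} {j} {k} i<j j≤k = ℤP.drop‿+<+ (subst₂ ℤ._<_ (sym (ℤP.∣-∣-≤ j≤k)) (sym (ℤP.∣-∣-≤ i≤k)) k-j<k-i)
  where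
  i≤k : i ℤ.≤ k
  i≤k = ℤP.≤-trans (ℤP.<⇒≤ i<j) j≤k
  k-j<k-i : k ℤ.- j ℤ.< k ℤ.- i
  k-j<k-i = ℤP.+-monoʳ-< k (ℤP.neg-mono-< i<j)

module Analysis (n m : ℕ) (ends : Fin m → Fin n × Fin n) (δ Tmax : ℕ) .{{_ : NonZero δ}} where
  open Game n m ends δ Tmax

  1≤δ : 1 ≤ δ
  1≤δ = ℕ.>-nonZero⁻¹ δ

  ⌈Tmax/δ⌉ : ℕ
  ⌈Tmax/δ⌉ = ceilDiv Tmax δ

  InWindow : ℤ → ℤ → Set
  InWindow t₀ t = t₀ ℤ.< t × t ℤ.≤ t₀ ℤ.+ + δ

  InWindow-next : ∀ t → InWindow t (t ℤ.+ + 1)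
  InWindow-next t = i<i+1 t , ℤP.+-monoʳ-≤ t (+≤+ 1≤δ)

  _≟ₛ_ : (σ σ′ : Seed) → Dec (σ ≡ σ′)
  _≟ₛ_ = ≡-dec _≟ᶠ_ ℤ._≟_

  ConsistentRound : (Fin m → ℕ) → Round → Set
  ConsistentRound lab (σ , L) = Consistent lab σ L

  Endpoint : Fin m → Fin n → Set
  Endpoint e v = proj₁ (ends e) ≡ v ⊎ proj₂ (ends e) ≡ v

  Joins : Fin m → Fin n → Fin n → Set
  Joins e u w = ends e ≡ (u , w) ⊎ ends e ≡ (w , u)

  shared-endpoint : ∀ {e e′} → ShareEnd e e′ → ∃ λ v → Endpoint e v × Endpoint e′ v
  shared-endpoint (inj₁ eq)               = _ , inj₁ refl , inj₁ (sym eq)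
  shared-endpoint (inj₂ (inj₁ eq))        = _ , inj₁ refl , inj₂ (sym eq)
  shared-endpoint (inj₂ (inj₂ (inj₁ eq))) = _ , inj₂ refl , inj₁ (sym eq)
  shared-endpoint (inj₂ (inj₂ (inj₂ eq))) = _ , inj₂ refl , inj₂ (sym eq)

  SameEnds-sym : ∀ {e e′} → SameEnds e e′ → SameEnds e′ e
  SameEnds-sym (inj₁ eq) = inj₁ (sym eq)
  SameEnds-sym (inj₂ eq) = inj₂ (cong swap (sym eq))

  Joins-SameEnds : ∀ {e e′ u w} → Joins e u w → SameEnds e′ e → Joins e′ u w
  Joins-SameEnds (inj₁ e≡uw) (inj₁ e′≡e)  = inj₁ (trans e′≡e e≡uw)
  Joins-SameEnds (inj₁ e≡uw) (inj₂ e′≡e˘) = inj₂ (trans e′≡e˘ (cong swap e≡uw))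
  Joins-SameEnds (inj₂ e≡wu) (inj₁ e′≡e)  = inj₂ (trans e′≡e e≡wu)
  Joins-SameEnds (inj₂ e≡wu) (inj₂ e′≡e˘) = inj₁ (trans e′≡e˘ (cong swap e≡wu))

  EdgeAt-sym : ∀ {lab u w s} → EdgeAt lab u w s → EdgeAt lab w u s
  EdgeAt-sym (e , inj₁ e≡uw , le≡s) = e , inj₂ e≡uw , le≡s
  EdgeAt-sym (e , inj₂ e≡wu , le≡s) = e , inj₁ e≡wu , le≡s

  -- Infection logs

  module ConsistentLog {lab : Fin m → ℕ} {v₀ : Fin n} {t₀ : ℤ} {L : Log} (consistent : Consistent lab (v₀ , t₀) L) where

    seed-entry : L v₀ ≡ just (v₀ , t₀)
    seed-entry = proj₁ consistent

    seed-entry-unique : ∀ {z s} → L v₀ ≡ just (z , s) → (z , s) ≡ (v₀ , t₀)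
    seed-entry-unique Lv₀ = just-injective (trans (sym Lv₀) seed-entry)

    seed-infectious : ∀ {t} → InWindow t₀ t → Infectious L v₀ t
    seed-infectious window = t₀ , (v₀ , seed-entry) , window

    infector : ∀ {x y s} → x ≢ v₀ → L x ≡ just (y , s) → Infectious L y s × EdgeAt lab y x s
    infector x≢v₀ Lx with infectious , edge , _ ← proj₂ (proj₂ consistent _ x≢v₀) _ _ Lx =
      infectious , edge

    logged-edge : ∀ {a b s} → a ≢ b → L b ≡ just (a , s) → EdgeAt lab a b s
    logged-edge {a} {b} a≢b Lb with b ≟ᶠ v₀
    ... | yes refl = contradiction (cong proj₁ (seed-entry-unique Lb)) a≢b
    ... | no b≢v₀  = proj₂ (infector b≢v₀ Lb)

    infection-time-ℕ : ∀ {x y s} → x ≢ v₀ → L x ≡ just (y , s) → ∃ λ N → s ≡ + N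
    infection-time-ℕ x≢v₀ Lx with _ , _ , le≡s ← proj₂ (infector x≢v₀ Lx) = _ , sym le≡s

    exposed⇒infected : ∀ {x s} → CanInfect lab L x s → x ≢ v₀ →
                       ∃₂ λ y s′ → L x ≡ just (y , s′) × s′ ℤ.≤ s
    exposed⇒infected {x} {s} exposed x≢v₀ with proj₂ consistent x x≢v₀ | L x in Lx
    ... | unexposed , _ | nothing = contradiction exposed (unexposed Lx s)
    ... | _ , infected | just (y , s′) with s ℤ.<? s′
    ...   | yes s<s′ = contradiction exposed (proj₂ (proj₂ (infected y s′ Lx)) s s<s′)
    ...   | no s≮s′  = y , s′ , refl , ℤP.≮⇒≥ s≮s′

    private
      AfterSeed : ℕ → Set
      AfterSeed N = ∀ {x y} → x ≢ v₀ → L x ≡ just (y , + N) → t₀ ℤ.< + N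

      after-seed : ∀ N → (∀ {N′} → N′ < N → AfterSeed N′) → AfterSeed N
      after-seed N earlier {x} {y} x≢v₀ Lx with infector x≢v₀ Lx
      ... | (sy , (_ , Ly) , sy<N , _) , _ with y ≟ᶠ v₀
      ...   | yes refl = subst (ℤ._< + N) (cong proj₂ (seed-entry-unique Ly)) sy<N
      ...   | no y≢v₀ with Ny , refl ← infection-time-ℕ y≢v₀ Ly =
        ℤP.<-trans (earlier (ℤP.drop‿+<+ sy<N) y≢v₀ Ly) sy<N

    infected-after-seed : ∀ {x y s} → x ≢ v₀ → L x ≡ just (y , s) → t₀ ℤ.< s
    infected-after-seed x≢v₀ Lx with N , refl ← infection-time-ℕ x≢v₀ Lx =
      <-rec AfterSeed after-seed N x≢v₀ Lx

    -- An infector other than v₀ would itself have been infected strictly between t₀ and t₀ + 1.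
    infected-next-step : ∀ {x} → x ≢ v₀ → EdgeAt lab v₀ x (t₀ ℤ.+ + 1) → L x ≡ just (v₀ , t₀ ℤ.+ + 1)
    infected-next-step x≢v₀ edge
      with y , s , Lx , s≤t₀+1 ← exposed⇒infected (v₀ , seed-infectious (InWindow-next t₀) , edge) x≢v₀
      with refl ← ℤP.≤-antisym s≤t₀+1 (i<j⇒i+1≤j (infected-after-seed x≢v₀ Lx))
      with y ≟ᶠ v₀
    ... | yes refl = Lx
    ... | no y≢v₀ with (_ , (_ , Ly) , sy<s , _) , _ ← infector x≢v₀ Lx =
      contradiction (ℤP.<-≤-trans sy<s (i<j⇒i+1≤j (infected-after-seed y≢v₀ Ly))) (ℤP.<-irrefl refl)

  -- Existence of consistent logs

  module Simulation (lab : Fin m → ℕ) (valid : ValidLab lab) where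

    infectious? : ∀ L u t → Dec (Infectious L u t)
    infectious? L u t with L u in Lu
    ... | nothing = no λ { (_ , (_ , ()) , _) }
    ... | just (x , s) with s ℤ.<? t | t ℤ.≤? s ℤ.+ + δ
    ...   | yes s<t | yes t≤s+δ = yes (s , (x , refl) , s<t , t≤s+δ)
    ...   | no s≮t  | _         = no λ { (_ , (_ , refl) , s<t , _) → s≮t s<t }
    ...   | yes _   | no t≰s+δ  = no λ { (_ , (_ , refl) , _ , t≤s+δ) → t≰s+δ t≤s+δ }

    edgeAt? : ∀ u w t → Dec (EdgeAt lab u w t)
    edgeAt? u w t = any? λ e → (ends e ≟ₑ (u , w) ⊎-dec ends e ≟ₑ (w , u)) ×-dec (+ lab e ℤ.≟ t)
      where
      _≟ₑ_ : (p q : Fin n × Fin n) → Dec (p ≡ q)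
      _≟ₑ_ = ≡-dec _≟ᶠ_ _≟ᶠ_

    canInfect? : ∀ L w t → Dec (CanInfect lab L w t)
    canInfect? L w t = any? λ u → infectious? L u t ×-dec edgeAt? u w t

    spread : ℤ → Log → Log
    spread t L w with L w
    ... | just entry = just entry
    ... | nothing with canInfect? L w t
    ...   | yes (u , _) = just (u , t)
    ...   | no _        = nothing

    data SpreadView (t : ℤ) (L : Log) (w : Fin n) : Maybe (Fin n × ℤ) → Set where
      kept  : ∀ {entry} → L w ≡ just entry → SpreadView t L w (just entry)
      fresh : ∀ {u} → L w ≡ nothing → Infectious L u t × EdgeAt lab u w t → SpreadView t L w (just (u , t))
      none  : L w ≡ nothing → ¬ CanInfect lab L w t → SpreadView t L w nothing

    spread-view : ∀ t L w → SpreadView t L w (spread t L w)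
    spread-view t L w with L w in Lw
    ... | just _ = kept Lw
    ... | nothing with canInfect? L w t
    ...   | yes (_ , exposure) = fresh Lw exposure
    ...   | no unexposed       = none Lw unexposed

    spread-keeps : ∀ {t L w entry} → L w ≡ just entry → spread t L w ≡ just entry
    spread-keeps Lw rewrite Lw = refl

    spread-new : ∀ {t L w x s} → spread t L w ≡ just (x , s) → L w ≡ just (x , s) ⊎ s ≡ t
    spread-new {t} {L} {w} spread≡ with spread t L w | spread-view t L w | spread≡
    ... | _ | kept Lw   | refl = inj₁ Lw
    ... | _ | fresh _ _ | refl = inj₂ refl

    infectious-spread⁺ : ∀ {t L u t′} → Infectious L u t′ → Infectious (spread t L) u t′
    infectious-spread⁺ {t} {L} {u} (s , (x , Lu) , window) = s , (x , spread-keeps {t} {L} {u} Lu) , window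

    infectious-spread⁻ : ∀ {t L u t′} → t′ ℤ.≤ t → Infectious (spread t L) u t′ → Infectious L u t′
    infectious-spread⁻ {t} {L} {u} t′≤t (s , (x , Lu) , s<t′ , t′≤s+δ) with spread-new {t} {L} {u} Lu
    ... | inj₁ Lu′  = s , (x , Lu′) , s<t′ , t′≤s+δ
    ... | inj₂ refl = contradiction (ℤP.<-≤-trans s<t′ t′≤t) (ℤP.<-irrefl refl)

    exposed-spread⁻ : ∀ {t L w t′} → t′ ℤ.≤ t → CanInfect lab (spread t L) w t′ → CanInfect lab L w t′
    exposed-spread⁻ {t} {L} t′≤t (u , infectious , edge) =
      u , infectious-spread⁻ {t} {L} t′≤t infectious , edge

    edge-time≥1 : ∀ {u w t} → EdgeAt lab u w t → + 1 ℤ.≤ t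
    edge-time≥1 (e , _ , refl) = +≤+ (proj₁ (proj₁ valid e))

    edge-time≤Tmax : ∀ {u w t} → EdgeAt lab u w t → t ℤ.≤ + Tmax
    edge-time≤Tmax (e , _ , refl) = +≤+ (proj₂ (proj₁ valid e))

    module _ (v₀ : Fin n) (t₀ : ℤ) where

      initial : Log
      initial w with w ≟ᶠ v₀
      ... | yes _ = just (v₀ , t₀)
      ... | no _  = nothing

      simulate : ℕ → Log
      simulate zero    = initial
      simulate (suc T) = spread (+ suc T) (simulate T)

      record Simulated (T : ℕ) (L : Log) : Set where
        field
          seed       : L v₀ ≡ just (v₀ , t₀)
          infected   : ∀ {w} → w ≢ v₀ → ∀ u t → L w ≡ just (u , t) →
                       t ℤ.≤ + T × Infectious L u t × EdgeAt lab u w t ×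
                       (∀ t′ → t′ ℤ.< t → ¬ CanInfect lab L w t′)
          uninfected : ∀ {w} → w ≢ v₀ → L w ≡ nothing → ∀ t → t ℤ.≤ + T → ¬ CanInfect lab L w t
      open Simulated

      simulated-initial : Simulated 0 initial
      simulated-initial .seed with v₀ ≟ᶠ v₀
      ... | yes _    = refl
      ... | no v₀≢v₀ = contradiction refl v₀≢v₀
      simulated-initial .infected {w} w≢v₀ _ _ Lw with w ≟ᶠ v₀
      ... | yes w≡v₀ = contradiction w≡v₀ w≢v₀
      simulated-initial .uninfected _ _ t t≤0 (_ , _ , edge) =
        contradiction (ℤP.≤-trans (edge-time≥1 edge) t≤0) λ { (+≤+ ()) }

      simulated-spread : ∀ {T L} → Simulated T L → Simulated (suc T) (spread (+ suc T) L)
      simulated-spread {T} {L} sim .seed = spread-keeps {+ suc T} {L} (sim .seed)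
      simulated-spread {T} {L} sim .infected {w} w≢v₀ u t Lw′
        with spread (+ suc T) L w | spread-view (+ suc T) L w | Lw′
      ... | _ | kept Lw | refl with t≤T , infectious , edge , earliest ← sim .infected w≢v₀ u t Lw =
        t≤1+T , infectious-spread⁺ {+ suc T} {L} infectious , edge ,
        λ t′ t′<t → earliest t′ t′<t ∘
                    exposed-spread⁻ {+ suc T} {L} (ℤP.<⇒≤ (ℤP.<-≤-trans t′<t t≤1+T))
        where
        t≤1+T : t ℤ.≤ + suc T
        t≤1+T = ℤP.≤-trans t≤T (+≤+ (ℕP.n≤1+n T))
      ... | _ | fresh Lw (infectious , edge) | refl =
        ℤP.≤-refl , infectious-spread⁺ {+ suc T} {L} infectious , edge ,
        λ t′ t′<t → sim .uninfected w≢v₀ Lw t′ (ℤP.i<j⇒i≤pred[j] t′<t) ∘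
                    exposed-spread⁻ {+ suc T} {L} (ℤP.<⇒≤ t′<t)
      simulated-spread {T} {L} sim .uninfected {w} w≢v₀ Lw′ t t≤1+T exposed
        with spread (+ suc T) L w | spread-view (+ suc T) L w | Lw′
      ... | _ | none Lw unexposed | refl with t ℤ.≤? + T
      ...   | yes t≤T = sim .uninfected w≢v₀ Lw t t≤T (exposed-spread⁻ {+ suc T} {L} t≤1+T exposed)
      ...   | no t≰T with refl ← ℤP.≤-antisym t≤1+T (ℤP.i<j⇒suc[i]≤j (ℤP.≰⇒> t≰T)) =
        unexposed (exposed-spread⁻ {+ suc T} {L} t≤1+T exposed)

      simulated : ∀ T → Simulated T (simulate T)
      simulated zero    = simulated-initial
      simulated (suc T) = simulated-spread (simulated T)

      simulation-consistent : Consistent lab (v₀ , t₀) (simulate Tmax)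
      simulation-consistent =
        sim .seed , λ w w≢v₀ → unexposed w≢v₀ , λ u t Lw → proj₂ (sim .infected w≢v₀ u t Lw)
        where
        sim : Simulated Tmax (simulate Tmax)
        sim = simulated Tmax
        unexposed : ∀ {w} → w ≢ v₀ → simulate Tmax w ≡ nothing →
                    ∀ t → ¬ CanInfect lab (simulate Tmax) w t
        unexposed w≢v₀ Lw t exposed@(_ , _ , edge) = sim .uninfected w≢v₀ Lw t (edge-time≤Tmax edge) exposed

    consistent-log : ∀ σ → ∃ (Consistent lab σ)
    consistent-log (v₀ , t₀) = simulate v₀ t₀ Tmax , simulation-consistent v₀ t₀

  module _ (lab : Fin m → ℕ) (valid : ValidLab lab) where
    open Simulation lab valid using (consistent-log)

    performed? : ∀ H σ → Dec (Performed H σ)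
    performed? H σ = Any.any? (λ r → proj₁ r ≟ₛ σ) H

    known? : ∀ H e → Dec (Known lab H e)
    known? H e = Any.any? (λ (_ , L) → ¬? (a ≟ᶠ b) ×-dec (L b ≟ₘ just (a , s) ⊎-dec L a ≟ₘ just (b , s))) H
      where
      s : ℤ
      s = + lab e
      a b : Fin n
      a = proj₁ (ends e)
      b = proj₂ (ends e)
      _≟ₘ_ : (x y : Maybe Seed) → Dec (x ≡ y)
      _≟ₘ_ = ≡-decₘ _≟ₛ_

    progress : ∀ s → Final lab s ⊎ ∃ (Step lab s)
    progress ⟨ H , [] ⟩ with all? (known? H)
    ... | yes all-known = inj₁ (refl , all-known)
    ... | no some-unknown with e , unknown ← ¬∀⟶∃¬ m _ (known? H) some-unknown =
      inj₂ (_ , iterate (proj₁ (ends e)) e (inj₁ refl) unknown)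
    progress ⟨ H , seeding u false (t ∷ ts) ls ∷ st ⟩ with L , consistent ← consistent-log (u , t) =
      inj₂ (_ , round L (inj₁ refl) consistent)
    progress ⟨ H , seeding u true (t ∷ ts) ls ∷ st ⟩ with performed? H (u , t) | consistent-log (u , t)
    ... | yes performed  | _              = inj₂ (_ , skip performed)
    ... | no unperformed | L , consistent = inj₂ (_ , round L (inj₂ unperformed) consistent)
    progress ⟨ H , seeding u b [] ls ∷ st ⟩       = inj₂ (_ , seeded)
    progress ⟨ H , calls [] ∷ st ⟩                = inj₂ (_ , return)
    progress ⟨ H , calls ((w , s) ∷ ps) ∷ st ⟩   = inj₂ (_ , call {xs = []})

  -- Uniqueness of the learned labelling

  Learned-sym : ∀ {H a b s} → Learned H a b s → Learned H b a s
  Learned-sym = Any.map λ (a≢b , entry) → a≢b ∘ sym , Sum.swap entry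

  Joins⇒Learned : ∀ {H e a b s} → Joins e a b →
                  Learned H (proj₁ (ends e)) (proj₂ (ends e)) s → Learned H a b s
  Joins⇒Learned {H} {s = s} (inj₁ e≡ab) = subst (λ (u , w) → Learned H u w s) e≡ab
  Joins⇒Learned {H} {s = s} (inj₂ e≡ba) = Learned-sym ∘ subst (λ (u , w) → Learned H u w s) e≡ba

  Learned⇒EdgeAt : ∀ {lab H} → All (ConsistentRound lab) H → ∀ {a b s} → Learned H a b s → EdgeAt lab a b s
  Learned⇒EdgeAt (consistent ∷ _) (here (a≢b , inj₁ Lb)) = ConsistentLog.logged-edge consistent a≢b Lb
  Learned⇒EdgeAt (consistent ∷ _) (here (a≢b , inj₂ La)) =
    EdgeAt-sym (ConsistentLog.logged-edge consistent (a≢b ∘ sym) La)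
  Learned⇒EdgeAt (_ ∷ consistent) (there learned) = Learned⇒EdgeAt consistent learned

  -- Every edge e of lab is matched by an edge φ e of lab′ with the same ends and label. Since lab has no equally
  -- labelled parallel edges, φ is injective, hence onto: every edge of lab′ is a matched one.
  all-known⇒wins : ∀ {lab} → ValidLab lab → ∀ {H} → (∀ e → Known lab H e) → Wins H
  all-known⇒wins {lab} (_ , unambiguous) {H} known lab′ _ consistent a b s =
    mk⇔ learned (Learned⇒EdgeAt consistent)
    where
    matched : ∀ e → EdgeAt lab′ (proj₁ (ends e)) (proj₂ (ends e)) (+ lab e)
    matched e = Learned⇒EdgeAt consistent (known e)
    φ : Fin m → Fin m
    φ e = proj₁ (matched e)
    φ-ends : ∀ e → SameEnds (φ e) e
    φ-ends e = proj₁ (proj₂ (matched e))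
    φ-label : ∀ e → + lab′ (φ e) ≡ + lab e
    φ-label e = proj₂ (proj₂ (matched e))
    φ-injective : Injective _≡_ _≡_ φ
    φ-injective {e₁} {e₂} φe₁≡φe₂ with e₁ ≟ᶠ e₂
    ... | yes e₁≡e₂ = e₁≡e₂
    ... | no e₁≢e₂  = contradiction (ℤP.+-injective same-label) (unambiguous e₁ e₂ e₁≢e₂ same-ends)
      where
      same-ends : SameEnds e₁ e₂
      same-ends = Joins-SameEnds (φ-ends e₂) (subst (SameEnds e₁) φe₁≡φe₂ (SameEnds-sym (φ-ends e₁)))
      same-label : + lab e₁ ≡ + lab e₂
      same-label = trans (sym (φ-label e₁)) (trans (cong (λ e → + lab′ e) φe₁≡φe₂) (φ-label e₂))
    learned : EdgeAt lab′ a b s → Learned H a b s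
    learned (e′ , joins , lab′e′≡s) with e , refl ← injective⇒surjective φ-injective e′ =
      subst (Learned H a b) (trans (sym (φ-label e)) lab′e′≡s)
        (Joins⇒Learned (Joins-SameEnds joins (SameEnds-sym (φ-ends e))) (known e))

  -- Main-loop seed times and Explore calls

  j*δ<Tmax⇒j<⌈Tmax/δ⌉ : ∀ j → j * δ < Tmax → j < ⌈Tmax/δ⌉
  j*δ<Tmax⇒j<⌈Tmax/δ⌉ j jδ<Tmax =
    subst (_≤ ⌈Tmax/δ⌉) (m*n/n≡m (suc j) δ) (/-monoˡ-≤ δ [1+j]δ≤Tmax+δ-1)
    where
    open ℕP.≤-Reasoning
    [1+j]δ≤Tmax+δ-1 : suc j * δ ≤ Tmax + (δ ∸ 1)
    [1+j]δ≤Tmax+δ-1 = begin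
      suc j * δ            ≡⟨ cong (_+ j * δ) (ℕP.suc-pred δ) ⟨
      suc (δ ∸ 1 + j * δ)  ≡⟨ ℕP.+-suc (δ ∸ 1) (j * δ) ⟨
      δ ∸ 1 + suc (j * δ)  ≤⟨ ℕP.+-monoʳ-≤ (δ ∸ 1) jδ<Tmax ⟩
      δ ∸ 1 + Tmax         ≡⟨ ℕP.+-comm (δ ∸ 1) Tmax ⟩
      Tmax + (δ ∸ 1)       ∎

  length-mainTimes : length mainTimes ≤ ⌈Tmax/δ⌉
  length-mainTimes = begin
    length mainTimes                    ≡⟨ length-map +_ seedTimes ⟩
    length seedTimes                    ≤⟨ unique-⊆⇒length≤ seedTimes! seedTimes⊆ ⟩
    length (map (_* δ) (upTo ⌈Tmax/δ⌉)) ≡⟨ length-map (_* δ) (upTo ⌈Tmax/δ⌉) ⟩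
    length (upTo ⌈Tmax/δ⌉)              ≡⟨ length-upTo ⌈Tmax/δ⌉ ⟩
    ⌈Tmax/δ⌉                            ∎
    where
    open ℕP.≤-Reasoning
    seedTimes : List ℕ
    seedTimes = filter (λ t → t ℕ.<? Tmax) (map (_* δ) (upTo (suc Tmax)))
    seedTimes! : Unique seedTimes
    seedTimes! = Unique.filter⁺ (λ t → t ℕ.<? Tmax)
                   (Unique.map⁺ (λ {i} {j} → ℕP.*-cancelʳ-≡ i j δ) (Unique.upTo⁺ (suc Tmax)))
    seedTimes⊆ : seedTimes ⊆ map (_* δ) (upTo ⌈Tmax/δ⌉)
    seedTimes⊆ t∈ with ∈-filter⁻ (λ t → t ℕ.<? Tmax) {xs = map (_* δ) (upTo (suc Tmax))} t∈
    ... | t∈′ , t<Tmax with ∈-map⁻ (_* δ) {xs = upTo (suc Tmax)} t∈′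
    ...   | j , _ , refl = ∈-map⁺ (_* δ) (∈-upTo⁺ (j*δ<Tmax⇒j<⌈Tmax/δ⌉ j t<Tmax))

  mainTimes-window : ∀ N → 1 ≤ N → N ≤ Tmax → ∃ λ t → t ∈ mainTimes × InWindow t (+ N)
  mainTimes-window (suc N) _ N<Tmax = + (j * δ) , jδ∈mainTimes , +<+ (s≤s jδ≤N) , +≤+ 1+N≤jδ+δ
    where
    j : ℕ
    j = N / δ
    jδ≤N : j * δ ≤ N
    jδ≤N = m/n*n≤m N δ
    1+N≤jδ+δ : suc N ≤ j * δ + δ
    1+N≤jδ+δ = begin
      suc N                ≡⟨ cong suc (m≡m%n+[m/n]*n N δ) ⟩
      suc (N % δ + j * δ)  ≤⟨ ℕP.+-monoˡ-≤ (j * δ) (m%n<n N δ) ⟩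
      δ + j * δ            ≡⟨ ℕP.+-comm δ (j * δ) ⟩
      j * δ + δ            ∎
      where open ℕP.≤-Reasoning
    jδ<Tmax : j * δ < Tmax
    jδ<Tmax = ℕP.≤-<-trans jδ≤N N<Tmax
    j<1+Tmax : j < suc Tmax
    j<1+Tmax = s≤s (ℕP.≤-trans (ℕP.m≤m*n j δ) (ℕP.<⇒≤ jδ<Tmax))
    jδ∈mainTimes : + (j * δ) ∈ mainTimes
    jδ∈mainTimes =
      ∈-map⁺ +_ (∈-filter⁺ (λ t → t ℕ.<? Tmax) (∈-map⁺ (_* δ) (∈-upTo⁺ j<1+Tmax)) jδ<Tmax)

  InfectedBy : Fin n → Fin n → ℤ → Log → Set
  InfectedBy u w s L = L w ≡ just (u , s) × w ≢ u

  open import Data.List.Membership.DecPropositional _≟ₛ_ using (_∈?_)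

  -- newInf picks entries with a function local to Defs, which cannot be named here: both directions inspect its
  -- value at w by abstracting L w in a hypothesis about it, which ∈-newInf⁺ gets by refuting non-membership.
  ∈-newInf⁻ : ∀ u ls {w s} → (w , s) ∈ newInf u ls → Any (InfectedBy u w s) ls
  ∈-newInf⁻ u ls ws∈ with find (∈-concatMap⁻ _ {xs = ls} (∈-deduplicate⁻ _≟ₛ_ _ ws∈))
  ... | L , L∈ls , ws∈picked with ∈-mapMaybe⁻ _ (allFin n) ws∈picked
  ...   | w , _ , picked with L w in Lw
  ...     | just (x , s) with x ≟ᶠ u | w ≟ᶠ u | picked
  ...       | yes refl | no w≢u | refl = lose L∈ls (Lw , w≢u)

  ∈-newInf⁺ : ∀ u ls {w s} → Any (InfectedBy u w s) ls → (w , s) ∈ newInf u ls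
  ∈-newInf⁺ u ls {w} {s} infected with find infected
  ... | L , L∈ls , Lw , w≢u with (w , s) ∈? newInf u ls
  ...   | yes ws∈ = ws∈
  ...   | no ws∉
    with ∉-mapMaybe _ (∈-allFin w)
           (λ ws∈picked → ws∉ (∈-deduplicate⁺ _≟ₛ_ (∈-concatMap⁺ _ (lose L∈ls ws∈picked))))
  ...     | not-picked with L w | Lw
  ...       | _ | refl with u ≟ᶠ u | w ≟ᶠ u
  ...         | yes _  | no _    = contradiction refl not-picked
  ...         | no u≢u | _       = contradiction refl u≢u
  ...         | yes _  | yes w≡u = contradiction w≡u w≢u

  -- Explored nodes

  Explored : Hist → Fin n → ℤ → Set
  Explored H u t = All (λ t′ → Performed H (u , t′)) (exploreTimes t)

  Explored⇒seeded : ∀ {H u t} → Explored H u t → Performed H (u , t)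
  Explored⇒seeded (_ ∷ _ ∷ performed ∷ []) = performed

  Explored⇒seeded-1 : ∀ {H u t} → Explored H u t → Performed H (u , t ℤ.- + 1)
  Explored⇒seeded-1 (_ ∷ performed ∷ _ ∷ []) = performed

  FollowedUp : Hist → Round → Set
  FollowedUp H ((u , _) , L) = ∀ {w s} → w ≢ u → L w ≡ just (u , s) → Explored H w s

  module _ (lab : Fin m → ℕ) (no-loops : ∀ e → proj₁ (ends e) ≢ proj₂ (ends e)) where

    EdgeAt⇒≢ : ∀ {u w s} → EdgeAt lab u w s → u ≢ w
    EdgeAt⇒≢ (e , inj₁ e≡uu , _) refl = no-loops e (trans (cong proj₁ e≡uu) (sym (cong proj₂ e≡uu)))
    EdgeAt⇒≢ (e , inj₂ e≡uu , _) refl = no-loops e (trans (cong proj₁ e≡uu) (sym (cong proj₂ e≡uu)))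

    edge-of : ∀ e → EdgeAt lab (proj₁ (ends e)) (proj₂ (ends e)) (+ lab e)
    edge-of e = e , inj₁ refl , refl

    module Propagation (H : Hist) (followed : All (λ r → ConsistentRound lab r × FollowedUp H r) H) where
      open ConsistentLog

      performed-round : ∀ {σ} → Performed H σ →
                        ∃ λ L → (σ , L) ∈ H × Consistent lab σ L × FollowedUp H (σ , L)
      performed-round performed with (_ , L) , r∈H , refl ← find performed = L , r∈H , All.lookup followed r∈H

      next-step-infection : ∀ {u x t} → Explored H u t → EdgeAt lab u x t →
        ∃ λ L → ((u , t ℤ.- + 1) , L) ∈ H × L x ≡ just (u , t) × FollowedUp H ((u , t ℤ.- + 1) , L)
      next-step-infection {u} {x} {t} explored edge
        with L , r∈H , consistent , followed-up ← performed-round (Explored⇒seeded-1 explored) =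
        L , r∈H , subst (λ t′ → L x ≡ just (u , t′)) (i-1+1≡i t) Lx , followed-up
        where
        Lx : L x ≡ just (u , t ℤ.- + 1 ℤ.+ + 1)
        Lx = infected-next-step consistent (EdgeAt⇒≢ (EdgeAt-sym edge))
                                (subst (EdgeAt lab u x) (sym (i-1+1≡i t)) edge)

      explored-step : ∀ {u x t} → Explored H u t → EdgeAt lab u x t → Explored H x t
      explored-step explored edge with _ , _ , Lx , followed-up ← next-step-infection explored edge =
        followed-up (EdgeAt⇒≢ (EdgeAt-sym edge)) Lx

      explored-learned : ∀ {u x t} → Explored H u t → EdgeAt lab u x t → Learned H u x t
      explored-learned explored edge with _ , r∈H , Lx , _ ← next-step-infection explored edge =
        Any.map (λ { refl → EdgeAt⇒≢ edge , inj₁ Lx }) r∈H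

      ExploredInfectees : ℕ → Set
      ExploredInfectees N = ∀ {v t₀ L x y} → Consistent lab (v , t₀) L → FollowedUp H ((v , t₀) , L) →
                            x ≢ v → L x ≡ just (y , + N) → Explored H x (+ N)

      ExploredNeighbours : ℕ → ℤ → Set
      ExploredNeighbours N t₀ =
        ∀ {u x} → Performed H (u , t₀) → InWindow t₀ (+ N) → EdgeAt lab u x (+ N) → Explored H x (+ N)

      -- Both properties are proved together, by induction on N and, for fixed N, on the distance from t₀ to N.
      infectee-explored : ∀ {N v t₀ L x y} → Consistent lab (v , t₀) L → FollowedUp H ((v , t₀) , L) →
        (∀ {N′} → N′ < N → ExploredInfectees N′) →
        (∀ {t₁} → t₀ ℤ.< t₁ → ExploredNeighbours N t₁) →
        x ≢ v → L x ≡ just (y , + N) → Explored H x (+ N)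
      infectee-explored {v = v} {y = y} consistent followed-up earlier closer x≢v Lx with y ≟ᶠ v
      ... | yes refl = followed-up x≢v Lx
      ... | no y≢v
        with (_ , (_ , Ly) , sy<N , N≤sy+δ) , edge ← infector consistent x≢v Lx
        with Ny , refl ← infection-time-ℕ consistent y≢v Ly =
        closer (infected-after-seed consistent y≢v Ly) y-seeded (sy<N , N≤sy+δ) edge
        where
        y-seeded : Performed H (y , + Ny)
        y-seeded = Explored⇒seeded (earlier (ℤP.drop‿+<+ sy<N) consistent followed-up y≢v Ly)

      neighbour-explored : ∀ {N t₀} → (∀ {N′} → N′ < N → ExploredInfectees N′) →
        (∀ {t₁} → t₀ ℤ.< t₁ → ExploredNeighbours N t₁) → ExploredNeighbours N t₀
      neighbour-explored {N} {t₀} earlier closer {u} {x} performed window edge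
        with x≢u ← EdgeAt⇒≢ (EdgeAt-sym edge)
        with L , _ , consistent , followed-up ← performed-round performed
        with _ , _ , Lx , s≤N ← exposed⇒infected consistent (u , seed-infectious consistent window , edge) x≢u
        with N₁ , refl ← infection-time-ℕ consistent x≢u Lx
        with N₁ ℕ.<? N
      ... | yes N₁<N = explored-step u-explored edge
        where
        t₀<N₁ : t₀ ℤ.< + N₁
        t₀<N₁ = infected-after-seed consistent x≢u Lx
        x-seeded : Performed H (x , + N₁)
        x-seeded = Explored⇒seeded (earlier N₁<N consistent followed-up x≢u Lx)
        N≤N₁+δ : + N ℤ.≤ + N₁ ℤ.+ + δ
        N≤N₁+δ = ℤP.≤-trans (proj₂ window) (ℤP.+-monoˡ-≤ (+ δ) (ℤP.<⇒≤ t₀<N₁))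
        u-explored : Explored H u (+ N)
        u-explored = closer t₀<N₁ x-seeded (+<+ N₁<N , N≤N₁+δ) (EdgeAt-sym edge)
      ... | no N₁≮N with refl ← ℕP.≤-antisym (ℤP.drop‿+≤+ s≤N) (ℕP.≮⇒≥ N₁≮N) =
        infectee-explored consistent followed-up earlier closer x≢u Lx

      explored-neighbours-from : ∀ N → (∀ {N′} → N′ < N → ExploredInfectees N′) →
        ∀ {t₀} → Acc _<_ ∣ t₀ ℤ.- + N ∣ → ExploredNeighbours N t₀
      explored-neighbours-from N earlier (acc nearer) = neighbour-explored earlier λ t₀<t₁ performed window →
        let t₁-nearer = ∣j-k∣<∣i-k∣ t₀<t₁ (ℤP.<⇒≤ (proj₁ window))
        in explored-neighbours-from N earlier (nearer t₁-nearer) performed window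

      explored-infectees : ∀ N → ExploredInfectees N
      explored-infectees = <-rec ExploredInfectees λ N earlier consistent followed-up →
        infectee-explored consistent followed-up earlier (λ _ → explored-neighbours-from N earlier (<-wellFounded _))

      explored-neighbour : ∀ {N t₀} → ExploredNeighbours N t₀
      explored-neighbour {N} = explored-neighbours-from N (λ {N′} _ → explored-infectees N′) (<-wellFounded _)

      -- The seed T − δ − 1 covers N < T, the seed T − 1 covers T ≤ N < T + δ, and the seed T covers N = T + δ.
      explored-window : ∀ {u T N} → Explored H u (+ T) → T ≤ N + δ → N ≤ T + δ →
                        ∃ λ t₀ → Performed H (u , t₀) × InWindow t₀ (+ N)
      explored-window {u} {T} {N} (early ∷ middle ∷ late ∷ []) T≤N+δ N≤T+δ with N ℕ.<? T | N ℕ.<? T + δ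
      ... | yes N<T | _ = _ , early ,
        i<j+k⇒i-k<j {+ T} {+ N} {+ suc δ} (+<+ (ℕP.≤-<-trans T≤N+δ (ℕP.+-monoʳ-< N (ℕP.n<1+n δ)))) ,
        j+k≤i+l⇒j≤i-k+l {+ T} {+ N} {+ suc δ} {+ δ}
          (+≤+ (subst (_≤ T + δ) (sym (ℕP.+-suc N δ)) (ℕP.+-monoˡ-≤ δ N<T)))
      ... | no N≮T | yes N<T+δ = _ , middle ,
        i<j+k⇒i-k<j {+ T} {+ N} {+ 1} (+<+ (ℕP.≤-<-trans (ℕP.≮⇒≥ N≮T) (ℕP.m<m+n N (s≤s z≤n)))) ,
        j+k≤i+l⇒j≤i-k+l {+ T} {+ N} {+ 1} {+ δ} (+≤+ (subst (_≤ T + δ) (ℕP.+-comm 1 N) N<T+δ))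
      ... | no _ | no N≮T+δ =
        _ , late , +<+ (ℕP.<-≤-trans (ℕP.m<m+n T 1≤δ) (ℕP.≮⇒≥ N≮T+δ)) , +≤+ N≤T+δ

      seeded-edge-explored : ∀ {u x t₀ N} → Performed H (u , t₀) → InWindow t₀ (+ N) → EdgeAt lab u x (+ N) →
                             Explored H x (+ N) × Explored H u (+ N)
      seeded-edge-explored {x = x} {N = N} performed window edge =
        x-explored , explored-step x-explored (EdgeAt-sym edge)
        where
        x-explored : Explored H x (+ N)
        x-explored = explored-neighbour performed window edge

      BothExplored : Fin m → Set
      BothExplored e = Explored H (proj₁ (ends e)) (+ lab e) × Explored H (proj₂ (ends e)) (+ lab e)

      endpoint-explored : ∀ {e v} → BothExplored e → Endpoint e v → Explored H v (+ lab e)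
      endpoint-explored (explored , _) (inj₁ refl) = explored
      endpoint-explored (_ , explored) (inj₂ refl) = explored

      seeded-endpoint-explored : ∀ {e v t₀} → Performed H (v , t₀) → InWindow t₀ (+ lab e) → Endpoint e v →
                                 BothExplored e
      seeded-endpoint-explored {e} performed window (inj₁ refl) =
        swap (seeded-edge-explored performed window (edge-of e))
      seeded-endpoint-explored {e} performed window (inj₂ refl) =
        seeded-edge-explored performed window (EdgeAt-sym (edge-of e))

      BothExplored-step : ∀ {e e′} → BothExplored e → DeltaRel lab e e′ → BothExplored e′
      BothExplored-step both (shared , le≤le′+δ , le′≤le+δ)
        with v , v∈e , v∈e′ ← shared-endpoint shared
        with t₀ , performed , window ← explored-window (endpoint-explored both v∈e) le≤le′+δ le′≤le+δ =
        seeded-endpoint-explored performed window v∈e′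

      BothExplored-star : ∀ {e e′} → BothExplored e → Star (DeltaRel lab) e e′ → BothExplored e′
      BothExplored-star both ε              = both
      BothExplored-star both (step ◅ steps) = BothExplored-star (BothExplored-step both step) steps

      BothExplored⇒Known : ∀ {e} → BothExplored e → Known lab H e
      BothExplored⇒Known {e} (explored , _) = explored-learned explored (edge-of e)

  -- The run of DiscoveryFollow on a fixed temporal multigraph

  module Execution (lab : Fin m → ℕ) (valid : ValidLab lab)
                   (no-loops : ∀ e → proj₁ (ends e) ≢ proj₂ (ends e))
                   (c : ℕ) (components : NumComponents lab c) where

    class : Fin m → Fin c
    class = proj₁ components

    bound : ℕ
    bound = 6 * m + c * ⌈Tmax/δ⌉

    Incident : Fin n × ℤ → Set
    Incident (w , s) = ∃ λ e → Endpoint e w × + lab e ≡ s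

    exploreSeedsOf : Fin m → List Seed
    exploreSeedsOf e = map (proj₁ (ends e) ,_) times ++ map (proj₂ (ends e) ,_) times
      where
      times : List ℤ
      times = exploreTimes (+ lab e)

    exploreSeeds : List Seed
    exploreSeeds = concatMap exploreSeedsOf (allFin m)

    length-exploreSeeds : length exploreSeeds ≡ 6 * m
    length-exploreSeeds = trans (length-concatMap (allFin m)) (cong (6 *_) (length-tabulate {n = m} id))
      where
      length-concatMap : ∀ es → length (concatMap exploreSeedsOf es) ≡ 6 * length es
      length-concatMap []       = refl
      length-concatMap (e ∷ es) = begin
        length (exploreSeedsOf e ++ concatMap exploreSeedsOf es)
          ≡⟨ length-++ (exploreSeedsOf e) {concatMap exploreSeedsOf es} ⟩
        6 + length (concatMap exploreSeedsOf es)
          ≡⟨ cong (_+_ 6) (length-concatMap es) ⟩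
        6 + 6 * length es
          ≡⟨ ℕP.*-suc 6 (length es) ⟨
        6 * suc (length es)
          ∎
        where open ≡-Reasoning

    exploreSeed∈ : ∀ {w s t} → Incident (w , s) → t ∈ exploreTimes s → (w , t) ∈ exploreSeeds
    exploreSeed∈ (e , inj₁ refl , refl) t∈ =
      ∈-concatMap⁺ exploreSeedsOf (lose (∈-allFin e) (∈-++⁺ˡ (∈-map⁺ (proj₁ (ends e) ,_) t∈)))
    exploreSeed∈ (e , inj₂ refl , refl) t∈ =
      ∈-concatMap⁺ exploreSeedsOf (lose (∈-allFin e) (∈-++⁺ʳ (map (proj₁ (ends e) ,_) (exploreTimes (+ lab e)))
                                                               (∈-map⁺ (proj₂ (ends e) ,_) t∈)))

    EdgeAt⇒Incident : ∀ {u w s} → EdgeAt lab u w s → Incident (w , s)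
    EdgeAt⇒Incident (e , inj₁ e≡uw , le≡s) = e , inj₂ (cong proj₂ e≡uw) , le≡s
    EdgeAt⇒Incident (e , inj₂ e≡wu , le≡s) = e , inj₁ (cong proj₁ e≡wu) , le≡s

    ConsistentFrom : Fin n → Log → Set
    ConsistentFrom u L = ∃ λ t → Consistent lab (u , t) L

    newInf-incident : ∀ {u ls} → All (ConsistentFrom u) ls → All Incident (newInf u ls)
    newInf-incident {u} {ls} logs = All.tabulate λ ws∈ →
      let (_ , consistent) , (Lw , w≢u) = All.lookupAny logs (∈-newInf⁻ u ls ws∈)
      in EdgeAt⇒Incident (ConsistentLog.logged-edge consistent (w≢u ∘ sym) Lw)

    ExploreFrame : Frame → Set
    ExploreFrame (seeding u b ts ls) =
      b ≡ true × (∃ λ s → Incident (u , s) × All (_∈ exploreTimes s) ts) × All (ConsistentFrom u) ls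
    ExploreFrame (calls ps) = All Incident ps

    MainFrame : Fin n → ℕ → ℕ → Hist → Frame → Set
    MainFrame v₀ budget k H (seeding u b ts ls) =
      u ≡ v₀ × b ≡ false × k + length ts ≤ budget ×
      All (λ t → t ∈ ts ⊎ Performed H (v₀ , t)) mainTimes × All (ConsistentFrom v₀) ls
    MainFrame v₀ budget k H (calls ps) =
      k ≤ budget × All (λ t → Performed H (v₀ , t)) mainTimes × All Incident ps

    data WellFormed (v₀ : Fin n) (budget k : ℕ) (H : Hist) : List Frame → Set where
      main   : ∀ {f} → MainFrame v₀ budget k H f → WellFormed v₀ budget k H (f ∷ [])
      pushed : ∀ {f st} → ExploreFrame f → WellFormed v₀ budget k H st → WellFormed v₀ budget k H (f ∷ st)

    -- The exploration of w at s is owed by a frame whose logs record the infection, by the frame Explore(w, s)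
    -- itself, or by a pending call.
    PendingIn : Hist → Fin n → ℤ → Frame → Set
    PendingIn H w s (seeding u b ts ls) =
      Any (InfectedBy u w s) ls ⊎ (u ≡ w × All (λ t → t ∈ ts ⊎ Performed H (w , t)) (exploreTimes s))
    PendingIn H w s (calls ps) = (w , s) ∈ ps

    Pending : Hist → List Frame → Fin n → ℤ → Set
    Pending H st w s = Any (PendingIn H w s) st

    Obligation : Hist → List Frame → Round → Set
    Obligation H st ((u , _) , L) = ∀ {w s} → w ≢ u → L w ≡ just (u , s) → Explored H w s ⊎ Pending H st w s

    ComponentKnown : Hist → Fin c → Set
    ComponentKnown H i = ∀ e → class e ≡ i → Known lab H e

    record Ledger : Set where
      constructor ledger
      field
        finished      : List (Fin c)
        exploreRounds : List Seed
        mainRounds    : ℕ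
    open Ledger

    -- Main-loop rounds get a budget of ⌈Tmax/δ⌉ per finished component, plus one for the running main loop.
    StackInvariant : Hist → List Frame → Ledger → Set
    StackInvariant H []         g = mainRounds g ≤ length (finished g) * ⌈Tmax/δ⌉
    StackInvariant H st@(_ ∷ _) g = ∃₂ λ v₀ e → Endpoint e v₀ × class e ∉ finished g ×
                                    WellFormed v₀ (suc (length (finished g)) * ⌈Tmax/δ⌉) (mainRounds g) H st

    record Invariant (s : State) (g : Ledger) : Set where
      field
        consistent        : All (ConsistentRound lab) (hist s)
        obligations       : All (Obligation (hist s) (stack s)) (hist s)
        finished-unique   : Unique (finished g)
        finished-known    : All (ComponentKnown (hist s)) (finished g)
        explore-unique    : Unique (exploreRounds g)
        explore-performed : All (Performed (hist s)) (exploreRounds g)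
        explore-seeds     : exploreRounds g ⊆ exploreSeeds
        rounds-split      : length (hist s) ≡ mainRounds g + length (exploreRounds g)
        stack-ok          : StackInvariant (hist s) (stack s) g
    open Invariant

    drop-empty-call : ∀ {H st w s} → Explored H w s ⊎ Pending H (calls [] ∷ st) w s →
                                      Explored H w s ⊎ Pending H st w s
    drop-empty-call (inj₁ explored)        = inj₁ explored
    drop-empty-call (inj₂ (there pending)) = inj₂ pending

    settled : ∀ {H r} → Obligation H (calls [] ∷ []) r → FollowedUp H r
    settled obligation w≢u Lw with drop-empty-call (obligation w≢u Lw)
    ... | inj₁ explored = explored
    ... | inj₂ ()

    component-known : ∀ {H v₀ e} → All (ConsistentRound lab) H → All (Obligation H (calls [] ∷ [])) H →
                      All (λ t → Performed H (v₀ , t)) mainTimes → Endpoint e v₀ → ComponentKnown H (class e)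
    component-known {H} {v₀} {e} consistent obligations main-seeded v₀∈e e′ e′∼e =
      BothExplored⇒Known (BothExplored-star e-explored e↝e′)
      where
      e↝e′ : Star (DeltaRel lab) e e′
      e↝e′ = Equivalence.to (proj₂ (proj₂ components) e e′) (sym e′∼e)
      open Propagation lab no-loops H (All.zipWith (λ {r} → map₂ (settled {H} {r})) (consistent , obligations))
      e-explored : BothExplored e
      e-explored with t , t∈ , window ← mainTimes-window (lab e) (proj₁ (proj₁ valid e)) (proj₂ (proj₁ valid e))
        = seeded-endpoint-explored (All.lookup main-seeded t∈) window v₀∈e

    _⊑_ : Hist → Hist → Set₁
    H ⊑ H′ = ∀ {P : Round → Set} → Any P H → Any P H′

    module _ {H H′ : Hist} (H⊑H′ : H ⊑ H′) where

      Explored-⊑ : ∀ {u t} → Explored H u t → Explored H′ u t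
      Explored-⊑ = All.map H⊑H′

      PendingIn-⊑ : ∀ {w s f} → PendingIn H w s f → PendingIn H′ w s f
      PendingIn-⊑ {f = seeding _ _ _ _} (inj₁ infected) = inj₁ infected
      PendingIn-⊑ {f = seeding _ _ _ _} (inj₂ (refl , exploring)) =
        inj₂ (refl , All.map (Sum.map₂ H⊑H′) exploring)
      PendingIn-⊑ {f = calls _} pending = pending

      MainFrame-⊑ : ∀ {v₀ budget k f} → MainFrame v₀ budget k H f → MainFrame v₀ budget k H′ f
      MainFrame-⊑ {f = seeding _ _ _ _} (u≡v₀ , b≡false , budget-ok , mains , logs) =
        u≡v₀ , b≡false , budget-ok , All.map (Sum.map₂ H⊑H′) mains , logs
      MainFrame-⊑ {f = calls _} (budget-ok , mains , incident) = budget-ok , All.map H⊑H′ mains , incident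

      WellFormed-⊑ : ∀ {v₀ budget k st} → WellFormed v₀ budget k H st → WellFormed v₀ budget k H′ st
      WellFormed-⊑ (main frame)        = main (MainFrame-⊑ frame)
      WellFormed-⊑ (pushed frame rest) = pushed frame (WellFormed-⊑ rest)

      ComponentKnown-⊑ : ∀ {i} → ComponentKnown H i → ComponentKnown H′ i
      ComponentKnown-⊑ known e class≡ = H⊑H′ (known e class≡)

      advance : ∀ {u v t t′ ts} → Performed H′ (u , t) → u ≡ v →
                t′ ∈ t ∷ ts ⊎ Performed H (v , t′) → t′ ∈ ts ⊎ Performed H′ (v , t′)
      advance seeded-now refl (inj₁ (here refl))    = inj₂ seeded-now
      advance _          refl (inj₁ (there t′∈ts)) = inj₁ t′∈ts
      advance _          refl (inj₂ performed)     = inj₂ (H⊑H′ performed)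

      seed-next : ∀ {u b t ts ls ls′ st} → Performed H′ (u , t) →
        (∀ {w s} → Any (InfectedBy u w s) ls → Any (InfectedBy u w s) ls′) →
        ∀ {w s} → Explored H w s ⊎ Pending H (seeding u b (t ∷ ts) ls ∷ st) w s →
                  Explored H′ w s ⊎ Pending H′ (seeding u b ts ls′ ∷ st) w s
      seed-next _ _ (inj₁ explored) = inj₁ (Explored-⊑ explored)
      seed-next _ more-logs (inj₂ (here (inj₁ infected))) = inj₂ (here (inj₁ (more-logs infected)))
      seed-next seeded-now _ (inj₂ (here (inj₂ (u≡w , exploring)))) =
        inj₂ (here (inj₂ (u≡w , All.map (advance seeded-now u≡w) exploring)))
      seed-next _ _ (inj₂ (there pending)) = inj₂ (there (Any.map PendingIn-⊑ pending))

    length-finished≤c : ∀ {D : List (Fin c)} → Unique D → length D ≤ c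
    length-finished≤c {D} D! =
      subst (length D ≤_) (length-tabulate {n = c} id) (unique-⊆⇒length≤ D! λ {i} _ → ∈-allFin i)

    WellFormed⇒within-budget : ∀ {v₀ budget k H st} → WellFormed v₀ budget k H st → k ≤ budget
    WellFormed⇒within-budget {k = k} (main {seeding _ _ ts _} (_ , _ , budget-ok , _)) =
      ℕP.≤-trans (ℕP.m≤m+n k (length ts)) budget-ok
    WellFormed⇒within-budget (main {calls _} (budget-ok , _)) = budget-ok
    WellFormed⇒within-budget (pushed _ rest)                  = WellFormed⇒within-budget rest

    mainRounds≤ : ∀ {H st g} → Unique (finished g) → StackInvariant H st g → mainRounds g ≤ c * ⌈Tmax/δ⌉
    mainRounds≤ {st = []} finished! budget-ok =
      ℕP.≤-trans budget-ok (ℕP.*-monoˡ-≤ ⌈Tmax/δ⌉ (length-finished≤c finished!))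
    mainRounds≤ {st = _ ∷ _} {g} finished! (_ , e , _ , fresh , well-formed) =
      ℕP.≤-trans (WellFormed⇒within-budget well-formed)
        (ℕP.*-monoˡ-≤ ⌈Tmax/δ⌉ (length-finished≤c (AllP.¬Any⇒All¬ (finished g) fresh ∷ finished!)))

    rounds≤bound : ∀ {s g} → Invariant s g → rounds s ≤ bound
    rounds≤bound {s} {g} I = begin
      length (hist s)                          ≡⟨ I .rounds-split ⟩
      mainRounds g + length (exploreRounds g)  ≤⟨ ℕP.+-mono-≤ main≤ explore≤ ⟩
      c * ⌈Tmax/δ⌉ + 6 * m                     ≡⟨ ℕP.+-comm (c * ⌈Tmax/δ⌉) (6 * m) ⟩
      bound                                    ∎
      where
      open ℕP.≤-Reasoning
      main≤ : mainRounds g ≤ c * ⌈Tmax/δ⌉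
      main≤ = mainRounds≤ (I .finished-unique) (I .stack-ok)
      explore≤ : length (exploreRounds g) ≤ 6 * m
      explore≤ = subst (_ ≤_) length-exploreSeeds (unique-⊆⇒length≤ (I .explore-unique) (I .explore-seeds))

    idle : List Frame → ℕ
    idle []      = 1
    idle (_ ∷ _) = 0

    -- A pending call weighs 6 while the Explore frame replacing it weighs 5, and a seeding frame whose rounds are
    -- done weighs one more than the frame of calls replacing it.
    weight : Frame → ℕ
    weight (seeding u _ ts ls) = length ts + 6 * length (newInf u ls) + 2
    weight (calls ps)          = 6 * length ps + 1

    stackWeight : List Frame → ℕ
    stackWeight []       = 0
    stackWeight (f ∷ st) = weight f + stackWeight st

    Measure : Set
    Measure = ℕ × ℕ × ℕ × ℕ

    -- A round may add calls to the stack, so the remaining round budget precedes the stack weight.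
    measure : State → Ledger → Measure
    measure s g = c ∸ length (finished g) , idle (stack s) , bound ∸ length (hist s) , stackWeight (stack s)

    _⊏_ : Measure → Measure → Set
    _⊏_ = ×-Lex _≡_ _<_ (×-Lex _≡_ _<_ (×-Lex _≡_ _<_ _<_))

    ⊏-wellFounded : WellFounded _⊏_
    ⊏-wellFounded =
      ×-wellFounded <-wellFounded (×-wellFounded <-wellFounded (×-wellFounded <-wellFounded <-wellFounded))

    ⊏-finishing : ∀ {a a′ rest rest′} → a′ < a → (a′ , rest′) ⊏ (a , rest)
    ⊏-finishing = inj₁

    ⊏-idle : ∀ {a i i′ rest rest′} → i′ < i → (a , i′ , rest′) ⊏ (a , i , rest)
    ⊏-idle i′<i = inj₂ (refl , inj₁ i′<i)

    ⊏-rounds : ∀ {a i r r′ w w′} → r′ < r → (a , i , r′ , w′) ⊏ (a , i , r , w)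
    ⊏-rounds r′<r = inj₂ (refl , inj₂ (refl , inj₁ r′<r))

    ⊏-weight : ∀ {a i r w w′} → w′ < w → (a , i , r , w′) ⊏ (a , i , r , w)
    ⊏-weight w′<w = inj₂ (refl , inj₂ (refl , inj₂ (refl , w′<w)))

    Preserved : State → Ledger → State → Set
    Preserved s g s′ = ∃ λ g′ → Invariant s′ g′ × measure s′ g′ ⊏ measure s g

    map-obligations : ∀ {H H′ st st′ rs} →
      (∀ {w s} → Explored H w s ⊎ Pending H st w s → Explored H′ w s ⊎ Pending H′ st′ w s) →
      All (Obligation H st) rs → All (Obligation H′ st′) rs
    map-obligations {H} {H′} {st} {st′} f =
      All.map {P = Obligation H st} {Q = Obligation H′ st′} λ obligation w≢u Lw → f (obligation w≢u Lw)

    restack : ∀ {H st st′ g} → Invariant ⟨ H , st ⟩ g →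
      (∀ {w s} → Explored H w s ⊎ Pending H st w s → Explored H w s ⊎ Pending H st′ w s) →
      StackInvariant H st′ g → Invariant ⟨ H , st′ ⟩ g
    restack I pending′ stack-ok′ = record
      { consistent        = I .consistent
      ; obligations       = map-obligations pending′ (I .obligations)
      ; finished-unique   = I .finished-unique
      ; finished-known    = I .finished-known
      ; explore-unique    = I .explore-unique
      ; explore-performed = I .explore-performed
      ; explore-seeds     = I .explore-seeds
      ; rounds-split      = I .rounds-split
      ; stack-ok          = stack-ok′
      }

    module RoundStep {H : Hist} {u : Fin n} {b : Bool} {t : ℤ} {ts : List ℤ} {ls : List Log} {st : List Frame}
                     {g : Ledger} (L : Log) (L-consistent : Consistent lab (u , t) L)
                     (I : Invariant ⟨ H , seeding u b (t ∷ ts) ls ∷ st ⟩ g) where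
      H′ : Hist
      H′ = H ++ [ ((u , t) , L) ]

      H⊑H′ : H ⊑ H′
      H⊑H′ = AnyP.++⁺ˡ

      seeded-now : Performed H′ (u , t)
      seeded-now = AnyP.++⁺ʳ H (here refl)

      length-H′ : length H′ ≡ suc (length H)
      length-H′ = trans (length-++ H) (ℕP.+-comm (length H) 1)

      consistent′ : All (ConsistentRound lab) H′
      consistent′ = AllP.++⁺ (I .consistent) (L-consistent ∷ [])

      obligations′ : All (Obligation H′ (seeding u b ts (L ∷ ls) ∷ st)) H′
      obligations′ = AllP.++⁺ (map-obligations (seed-next H⊑H′ seeded-now there) (I .obligations))
                              ((λ w≢u Lw → inj₂ (here (inj₁ (here (Lw , w≢u))))) ∷ [])

      finished-known′ : All (ComponentKnown H′) (finished g)
      finished-known′ = All.map (ComponentKnown-⊑ H⊑H′) (I .finished-known)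

      rounds-decrease : ∀ {g′} → Invariant ⟨ H′ , seeding u b ts (L ∷ ls) ∷ st ⟩ g′ →
                        bound ∸ length H′ < bound ∸ length H
      rounds-decrease I′ = ℕP.∸-monoʳ-< (ℕP.≤-reflexive (sym length-H′)) (rounds≤bound I′)

    preserve-round : ∀ {H u b t ts ls st g} L → (b ≡ false ⊎ ¬ Performed H (u , t)) → Consistent lab (u , t) L →
      Invariant ⟨ H , seeding u b (t ∷ ts) ls ∷ st ⟩ g →
      Preserved ⟨ H , seeding u b (t ∷ ts) ls ∷ st ⟩ g ⟨ H ++ [ ((u , t) , L) ] , seeding u b ts (L ∷ ls) ∷ st ⟩
    preserve-round {H} {u} {b} {t} {ts} {ls} {st} {g} L new-or-main L-consistent I with I .stack-ok
    ... | v₀ , e , v₀∈e , fresh , main (refl , refl , budget-ok , mains , logs) =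
      g′ , I′ , ⊏-rounds (rounds-decrease I′)
      where
      open RoundStep L L-consistent I
      g′ : Ledger
      g′ = record g { mainRounds = suc (mainRounds g) }
      I′ : Invariant ⟨ H′ , seeding u b ts (L ∷ ls) ∷ st ⟩ g′
      I′ = record
        { consistent        = consistent′
        ; obligations       = obligations′
        ; finished-unique   = I .finished-unique
        ; finished-known    = finished-known′
        ; explore-unique    = I .explore-unique
        ; explore-performed = All.map H⊑H′ (I .explore-performed)
        ; explore-seeds     = I .explore-seeds
        ; rounds-split      = trans length-H′ (cong suc (I .rounds-split))
        ; stack-ok          = v₀ , e , v₀∈e , fresh , main
            ( refl , refl , subst (_≤ suc (length (finished g)) * ⌈Tmax/δ⌉) (ℕP.+-suc (mainRounds g) (length ts)) budget-ok
            , All.map (advance H⊑H′ seeded-now refl) mains , (t , L-consistent) ∷ logs )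
        }
    ... | v₀ , e , v₀∈e , fresh , pushed (refl , (s , incident , ts-explore) , logs) rest =
      g′ , I′ , ⊏-rounds (rounds-decrease I′)
      where
      open RoundStep L L-consistent I
      new : ¬ Performed H (u , t)
      new = Sum.[ (λ ()) , id ] new-or-main
      g′ : Ledger
      g′ = record g { exploreRounds = (u , t) ∷ exploreRounds g }
      I′ : Invariant ⟨ H′ , seeding u b ts (L ∷ ls) ∷ st ⟩ g′
      I′ = record
        { consistent        = consistent′
        ; obligations       = obligations′
        ; finished-unique   = I .finished-unique
        ; finished-known    = finished-known′
        ; explore-unique    = AllP.¬Any⇒All¬ (exploreRounds g) (new ∘ All.lookup (I .explore-performed)) ∷ I .explore-unique
        ; explore-performed = seeded-now ∷ All.map H⊑H′ (I .explore-performed)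
        ; explore-seeds     = λ { (here refl) → exploreSeed∈ incident (All.head ts-explore)
                                ; (there σ∈)  → I .explore-seeds σ∈ }
        ; rounds-split      = trans length-H′ (trans (cong suc (I .rounds-split))
                                (sym (ℕP.+-suc (mainRounds g) (length (exploreRounds g)))))
        ; stack-ok          = v₀ , e , v₀∈e , fresh ,
            pushed (refl , (s , incident , All.tail ts-explore) , (t , L-consistent) ∷ logs) (WellFormed-⊑ H⊑H′ rest)
        }

    preserve-skip : ∀ {H u t ts ls st g} → Performed H (u , t) →
      Invariant ⟨ H , seeding u true (t ∷ ts) ls ∷ st ⟩ g →
      Preserved ⟨ H , seeding u true (t ∷ ts) ls ∷ st ⟩ g ⟨ H , seeding u true ts ls ∷ st ⟩
    preserve-skip {u = u} {ts = ts} {ls} {g = g} performed I with I .stack-ok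
    ... | v₀ , e , v₀∈e , fresh , pushed (refl , (s , incident , ts-explore) , logs) rest =
      g , restack I (seed-next id performed id) (v₀ , e , v₀∈e , fresh , pushed frame′ rest) , ⊏-weight (ℕP.n<1+n _)
      where
      frame′ : ExploreFrame (seeding u true ts ls)
      frame′ = refl , (s , incident , All.tail ts-explore) , logs

    preserve-seeded : ∀ {H u b ls st g} → Invariant ⟨ H , seeding u b [] ls ∷ st ⟩ g →
      Preserved ⟨ H , seeding u b [] ls ∷ st ⟩ g ⟨ H , calls (newInf u ls) ∷ st ⟩
    preserve-seeded {H} {u} {b} {ls} {st} {g} I =
      g , restack I called (stack-ok′ (I .stack-ok))
        , ⊏-weight (ℕP.+-monoˡ-< (stackWeight st) (ℕP.+-monoʳ-< (6 * length (newInf u ls)) (ℕP.n<1+n 1)))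
      where
      performed : ∀ {P : ℤ → Set} {t} → t ∈ [] ⊎ P t → P t
      performed = Sum.[ (λ ()) , id ]
      called : ∀ {w s} → Explored H w s ⊎ Pending H (seeding u b [] ls ∷ st) w s →
               Explored H w s ⊎ Pending H (calls (newInf u ls) ∷ st) w s
      called (inj₁ explored)                         = inj₁ explored
      called (inj₂ (here (inj₁ infected)))           = inj₂ (here (∈-newInf⁺ u ls infected))
      called (inj₂ (here (inj₂ (refl , exploring)))) = inj₁ (All.map (performed {Performed H ∘ (u ,_)}) exploring)
      called (inj₂ (there pending))                  = inj₂ (there pending)
      stack-ok′ : StackInvariant H (seeding u b [] ls ∷ st) g → StackInvariant H (calls (newInf u ls) ∷ st) g
      stack-ok′ (v₀ , e , v₀∈e , fresh , main (refl , refl , budget-ok , mains , logs)) =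
        v₀ , e , v₀∈e , fresh , main
          ( subst (_≤ suc (length (finished g)) * ⌈Tmax/δ⌉) (ℕP.+-identityʳ (mainRounds g)) budget-ok
          , All.map (performed {Performed H ∘ (v₀ ,_)}) mains , newInf-incident logs )
      stack-ok′ (v₀ , e , v₀∈e , fresh , pushed (refl , _ , logs) rest) =
        v₀ , e , v₀∈e , fresh , pushed (newInf-incident logs) rest

    call-weight : ∀ k W → 5 + (6 * k + 1 + W) < 6 * suc k + 1 + W
    call-weight k W = subst (λ x → 5 + (6 * k + 1 + W) < x + 1 + W) (sym (ℕP.*-suc 6 k)) ℕP.≤-refl

    preserve-call : ∀ {H xs w s ys st g} → Invariant ⟨ H , calls (xs ++ (w , s) ∷ ys) ∷ st ⟩ g →
      Preserved ⟨ H , calls (xs ++ (w , s) ∷ ys) ∷ st ⟩ g ⟨ H , explore w s ∷ calls (xs ++ ys) ∷ st ⟩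
    preserve-call {H} {xs} {w} {s} {ys} {st} {g} I =
      g , restack I started (stack-ok′ (I .stack-ok))
        , ⊏-weight (subst (λ k → 5 + (6 * length (xs ++ ys) + 1 + stackWeight st) < 6 * k + 1 + stackWeight st)
                          (sym (length-++-sucʳ xs (w , s) ys)) (call-weight (length (xs ++ ys)) (stackWeight st)))
      where
      started : ∀ {w′ s′} → Explored H w′ s′ ⊎ Pending H (calls (xs ++ (w , s) ∷ ys) ∷ st) w′ s′ →
                Explored H w′ s′ ⊎ Pending H (explore w s ∷ calls (xs ++ ys) ∷ st) w′ s′
      started (inj₁ explored) = inj₁ explored
      started (inj₂ (here called)) with ∈-++⁻ xs called
      ... | inj₁ in-xs         = inj₂ (there (here (∈-++⁺ˡ in-xs)))
      ... | inj₂ (here refl)   = inj₂ (here (inj₂ (refl , All.tabulate inj₁)))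
      ... | inj₂ (there in-ys) = inj₂ (there (here (∈-++⁺ʳ xs in-ys)))
      started (inj₂ (there pending)) = inj₂ (there (there pending))
      split : All Incident (xs ++ (w , s) ∷ ys) → Incident (w , s) × All Incident (xs ++ ys)
      split incident with incident-xs , (incident-ws ∷ incident-ys) ← AllP.++⁻ xs incident =
        incident-ws , AllP.++⁺ incident-xs incident-ys
      explore-frame : Incident (w , s) → ExploreFrame (explore w s)
      explore-frame incident = refl , (s , incident , All.tabulate id) , []
      stack-ok′ : StackInvariant H (calls (xs ++ (w , s) ∷ ys) ∷ st) g →
                  StackInvariant H (explore w s ∷ calls (xs ++ ys) ∷ st) g
      stack-ok′ (v₀ , e , v₀∈e , fresh , main (budget-ok , mains , incident))
        with incident-ws , rest ← split incident =
        v₀ , e , v₀∈e , fresh , pushed (explore-frame incident-ws) (main (budget-ok , mains , rest))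
      stack-ok′ (v₀ , e , v₀∈e , fresh , pushed incident below) with incident-ws , rest ← split incident =
        v₀ , e , v₀∈e , fresh , pushed (explore-frame incident-ws) (pushed rest below)

    preserve-return : ∀ {H st g} → Invariant ⟨ H , calls [] ∷ st ⟩ g →
                      Preserved ⟨ H , calls [] ∷ st ⟩ g ⟨ H , st ⟩
    preserve-return {H} {[]} {g} I with I .stack-ok
    ... | v₀ , e , v₀∈e , fresh , main (budget-ok , mains , []) =
      g′ , I′ , ⊏-finishing (ℕP.∸-monoʳ-< (ℕP.n<1+n _) (length-finished≤c finished′!))
      where
      g′ : Ledger
      g′ = record g { finished = class e ∷ finished g }
      finished′! : Unique (finished g′)
      finished′! = AllP.¬Any⇒All¬ (finished g) fresh ∷ I .finished-unique
      I′ : Invariant ⟨ H , [] ⟩ g′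
      I′ = record
        { consistent        = I .consistent
        ; obligations       = map-obligations drop-empty-call (I .obligations)
        ; finished-unique   = finished′!
        ; finished-known    = component-known (I .consistent) (I .obligations) mains v₀∈e ∷ I .finished-known
        ; explore-unique    = I .explore-unique
        ; explore-performed = I .explore-performed
        ; explore-seeds     = I .explore-seeds
        ; rounds-split      = I .rounds-split
        ; stack-ok          = budget-ok
        }
    preserve-return {H} {_ ∷ _} {g} I with I .stack-ok
    ... | v₀ , e , v₀∈e , fresh , pushed _ rest =
      g , restack I drop-empty-call (v₀ , e , v₀∈e , fresh , rest) , ⊏-weight (ℕP.n<1+n _)

    preserve-iterate : ∀ {H g} v₀ e → Endpoint e v₀ → ¬ Known lab H e → Invariant ⟨ H , [] ⟩ g →
      Preserved ⟨ H , [] ⟩ g ⟨ H , seeding v₀ false mainTimes [] ∷ [] ⟩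
    preserve-iterate {H} {g} v₀ e v₀∈e unknown I =
      g , restack I nothing-pending (v₀ , e , v₀∈e , fresh , main frame) , ⊏-idle (s≤s z≤n)
      where
      nothing-pending : ∀ {w s} → Explored H w s ⊎ Pending H [] w s →
                                  Explored H w s ⊎ Pending H (seeding v₀ false mainTimes [] ∷ []) w s
      nothing-pending (inj₁ explored) = inj₁ explored
      fresh : class e ∉ finished g
      fresh i∈ = unknown (All.lookup (I .finished-known) i∈ e refl)
      budget-ok : mainRounds g + length mainTimes ≤ suc (length (finished g)) * ⌈Tmax/δ⌉
      budget-ok = subst (mainRounds g + length mainTimes ≤_) (ℕP.+-comm (length (finished g) * ⌈Tmax/δ⌉) ⌈Tmax/δ⌉)
                        (ℕP.+-mono-≤ (I .stack-ok) length-mainTimes)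
      frame : MainFrame v₀ (suc (length (finished g)) * ⌈Tmax/δ⌉) (mainRounds g) H (seeding v₀ false mainTimes [])
      frame = refl , refl , budget-ok , All.tabulate inj₁ , []

    preserve : ∀ {s s′ g} → Step lab s s′ → Invariant s g → Preserved s g s′
    preserve (round L new-or-main L-consistent) = preserve-round L new-or-main L-consistent
    preserve (skip performed)                   = preserve-skip performed
    preserve seeded                             = preserve-seeded
    preserve call                               = preserve-call
    preserve return                             = preserve-return
    preserve (iterate v₀ e v₀∈e unknown)        = preserve-iterate v₀ e v₀∈e unknown

    initial-invariant : Invariant init (ledger [] [] 0)
    initial-invariant = record
      { consistent = [] ; obligations = [] ; finished-unique = [] ; finished-known = [] ; explore-unique = []
      ; explore-performed = [] ; explore-seeds = λ () ; rounds-split = refl ; stack-ok = z≤n }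

    reachable-invariant : ∀ {s₀ s g} → Invariant s₀ g → Star (Step lab) s₀ s → ∃ (Invariant s)
    reachable-invariant I ε              = _ , I
    reachable-invariant I (step ◅ steps) = reachable-invariant (proj₁ (proj₂ (preserve step I))) steps

    accessible : ∀ {s g} → Acc _⊏_ (measure s g) → Invariant s g → Acc (λ s′ s → Step lab s s′) s
    accessible (acc smaller) I = acc λ step →
      let _ , I′ , decreased = preserve step I in accessible (smaller decreased) I′

theorem14 : (n m : ℕ) (ends : Fin m → Fin n × Fin n) →
    (∀ e → proj₁ (ends e) ≢ proj₂ (ends e)) →
    (δ k : ℕ) → .{{_ : NonZero δ}} → 1 ≤ k →
    (Tmax : ℕ) (lab : Fin m → ℕ) → Game.ValidLab n m ends δ Tmax lab →
    (c : ℕ) → Game.NumComponents n m ends δ Tmax lab c →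
    Acc (λ s' s → Game.Step n m ends δ Tmax lab s s') (Game.init n m ends δ Tmax) ×
    (∀ s → Star (Game.Step n m ends δ Tmax lab) (Game.init n m ends δ Tmax) s →
      (Game.rounds n m ends δ Tmax s ≤ 6 * m + c * ceilDiv Tmax δ) ×
      (Game.Final n m ends δ Tmax lab s → Game.Wins n m ends δ Tmax (Game.history n m ends δ Tmax s)) ×
      (Game.Final n m ends δ Tmax lab s ⊎ ∃ (Game.Step n m ends δ Tmax lab s)))
-- k is unused: every round of DiscoveryFollow has a single seed.
theorem14 n m ends no-loops δ _ _ Tmax lab valid c components =
  accessible (⊏-wellFounded _) initial-invariant ,
  λ s init↝s → let _ , I = reachable-invariant initial-invariant init↝s in
    rounds≤bound I , (λ final → all-known⇒wins valid (proj₂ final)) , progress lab valid s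
  where
  open Analysis n m ends δ Tmax
  open Execution lab valid no-loops c components
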